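{- Let $r,k$ be integers that are coprime with $1\le k<r/3$, and let $A$ satisfy $\{0,k\}\subseteq A\subseteq[0,k]\subseteq\mathbb{Z}/r\mathbb{Z}$. Then: (1) If $(W,R)$ is Frame 1 and $w_0=x$, then $(W,R)$ is an impossibility frame under $\Gamma=\{\Box^jp,\lnot\Box^jp\}_{j\ge1}$. (2) If $(W,R)$ is Frame 2, $A$ is $k$-symmetric, and $w_0=0$, then $(W,R)$ is an impossibility frame under $\Gamma=\{(\Box\Diamond)^j\Box p,\lnot(\Box\Diamond)^j\Box p\}_{j\ge0}$.
   Context: For integers $a\le b$, $[a,b]=\{\overline a,\overline{a+1},\dots,\overline b\}\subseteq\mathbb{Z}/r\mathbb{Z}$. Frame 1: $W=\{x\}\sqcup\mathbb{Z}/r\mathbb{Z}$, $R=\{(x,a)\mid a\in A\}\sqcup\{(w,w+k)\mid w\in\mathbb{Z}/r\mathbb{Z}\}$. Frame 2: $W=\mathbb{Z}/r\mathbb{Z}$, $R=\{(w,w+a)\mid w\in\mathbb{Z}/r\mathbb{Z},a\in A\}$. $A$ is $k$-symmetric if $k-a\in A$ for all $a\in A$. Formulas are built from one variable $p$ with $\Box,\Diamond,\lnot$ under standard Kripke semantics ($w:p$ iff $w\in V$; $\Box$: all $R$-successors; $\Diamond$: some $R$-successor; $\lnot$: classical negation), with $\lnot\lnot\Phi$ identified with $\Phi$. For the fixed frame and world $w_0$: $\Gamma_0\subseteq\Gamma$ is consistent if some valuation $V\subseteq W$ makes every formula of $\Gamma_0$ true at $w_0$. $\Delta\subseteq\Gamma$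 is minimally inconsistent if for all $\Delta_0\subseteq\Delta$, $\Delta_0$ is inconsistent iff $\Delta_0=\Delta$. $\Gamma$ is minimally connected if some $\Gamma_0\subseteq\Gamma$ with $|\Gamma_0|\ge3$ is minimally inconsistent. For negation-free $\Phi,\Psi\in\Gamma$, $\Phi<_0\Psi$ means there is $\Gamma_0\subseteq\Gamma$ with $\Gamma_0\cup\{\Phi,\lnot\Psi\}$ minimally inconsistent and $\Gamma_0\cup\{\lnot\Phi,\Psi\}$ consistent. $\Gamma$ is strongly path-connected if for all negation-free $\Phi,\Psi\in\Gamma$ there is a chain $\Phi=\Phi_0<_0\Phi_1<_0\dots<_0\Phi_m=\Psi$. $(W,R)$ is an impossibility frame under $\Gamma$ if $\Gamma$ is minimally connected and strongly path-connected. -}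

module Defs where

open import Level using (0ℓ)
open import Data.Bool using (Bool; true; false; _∨_)
open import Data.Nat using (ℕ; zero; suc; _+_; _∸_; _≤_; _<_; NonZero)
open import Data.Nat.DivMod using (_mod_)
open import Data.Fin using (Fin; toℕ)
open import Data.Fin.Subset using (Subset; _∈_)
open import Data.Unit using (⊤; tt)
open import Data.Empty using (⊥)
open import Data.Sum using (_⊎_; inj₁; inj₂)
open import Data.Product using (Σ; _×_; _,_; ∃)
open import Relation.Nullary using (¬_; Dec; yes; no)
open import Relation.Nullary.Decidable using (⌊_⌋)
open import Relation.Binary.PropositionalEquality using (_≡_; refl; cong)
open import Relation.Binary.Construct.Closure.ReflexiveTransitive using (Star)
open import Function.Bundles using (_⇔_)

data Fm : Set where
  p   : Fm
  □_  : Fm → Fm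
  ◇_  : Fm → Fm
  ¬'_ : Fm → Fm

private
  □-inj : ∀ {φ ψ} → □ φ ≡ □ ψ → φ ≡ ψ
  □-inj refl = refl
  ◇-inj : ∀ {φ ψ} → ◇ φ ≡ ◇ ψ → φ ≡ ψ
  ◇-inj refl = refl
  ¬-inj : ∀ {φ ψ} → ¬' φ ≡ ¬' ψ → φ ≡ ψ
  ¬-inj refl = refl

_≟Fm_ : (φ ψ : Fm) → Dec (φ ≡ ψ)
p ≟Fm p = yes refl
p ≟Fm (□ ψ) = no (λ ())
p ≟Fm (◇ ψ) = no (λ ())
p ≟Fm (¬' ψ) = no (λ ())
(□ φ) ≟Fm p = no (λ ())
(□ φ) ≟Fm (□ ψ) with φ ≟Fm ψ
... | yes eq = yes (cong □_ eq)
... | no ne = no (λ e → ne (□-inj e))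
(□ φ) ≟Fm (◇ ψ) = no (λ ())
(□ φ) ≟Fm (¬' ψ) = no (λ ())
(◇ φ) ≟Fm p = no (λ ())
(◇ φ) ≟Fm (□ ψ) = no (λ ())
(◇ φ) ≟Fm (◇ ψ) with φ ≟Fm ψ
... | yes eq = yes (cong ◇_ eq)
... | no ne = no (λ e → ne (◇-inj e))
(◇ φ) ≟Fm (¬' ψ) = no (λ ())
(¬' φ) ≟Fm p = no (λ ())
(¬' φ) ≟Fm (□ ψ) = no (λ ())
(¬' φ) ≟Fm (◇ ψ) = no (λ ())
(¬' φ) ≟Fm (¬' ψ) with φ ≟Fm ψ
... | yes eq = yes (cong ¬'_ eq)
... | no ne = no (λ e → ne (¬-inj e))

NegFree : Fm → Set
NegFree p = ⊤
NegFree (□ φ) = NegFree φ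
NegFree (◇ φ) = NegFree φ
NegFree (¬' φ) = ⊥

□^ : ℕ → Fm → Fm
□^ zero φ = φ
□^ (suc j) φ = □ (□^ j φ)

□◇^ : ℕ → Fm → Fm
□◇^ zero φ = φ
□◇^ (suc j) φ = □ (◇ (□◇^ j φ))

record Frame : Set₁ where
  field
    W : Set
    R : W → W → Set

module _ (F : Frame) where
  open Frame F

  Sat : (W → Bool) → W → Fm → Set
  Sat V w p = V w ≡ true
  Sat V w (□ φ) = ∀ v → R w v → Sat V v φ
  Sat V w (◇ φ) = Σ W (λ v → R w v × Sat V v φ)
  Sat V w (¬' φ) = ¬ Sat V w φ

FmSet : Set
FmSet = Fm → Bool

_∈ˢ_ : Fm → FmSet → Set
φ ∈ˢ S = S φ ≡ true

_⊆ˢ_ : FmSet → FmSet → Set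
S ⊆ˢ T = ∀ φ → φ ∈ˢ S → φ ∈ˢ T

_⊆Γ_ : FmSet → (Fm → Set) → Set
S ⊆Γ Γ = ∀ φ → φ ∈ˢ S → Γ φ

_≐_ : FmSet → FmSet → Set
S ≐ T = ∀ φ → S φ ≡ T φ

_∪₂_ : FmSet → Fm × Fm → FmSet
(S ∪₂ (φ , ψ)) χ = S χ ∨ ⌊ χ ≟Fm φ ⌋ ∨ ⌊ χ ≟Fm ψ ⌋

module _ (F : Frame) (w₀ : Frame.W F) where
  open Frame F

  Consistent : FmSet → Set
  Consistent S = Σ (W → Bool) (λ V → ∀ φ → φ ∈ˢ S → Sat F V w₀ φ)

  Inconsistent : FmSet → Set
  Inconsistent S = ¬ Consistent S

  MinInconsistent : FmSet → Set
  MinInconsistent Δ = ∀ Δ₀ → Δ₀ ⊆ˢ Δ → (Inconsistent Δ₀ ⇔ (Δ₀ ≐ Δ))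

  module _ (Γ : Fm → Set) where

    MinimallyConnected : Set
    MinimallyConnected =
      Σ FmSet λ Γ₀ → Γ₀ ⊆Γ Γ ×
        (Σ Fm λ φ₁ → Σ Fm λ φ₂ → Σ Fm λ φ₃ →
           φ₁ ∈ˢ Γ₀ × φ₂ ∈ˢ Γ₀ × φ₃ ∈ˢ Γ₀ ×
           ¬ φ₁ ≡ φ₂ × ¬ φ₁ ≡ φ₃ × ¬ φ₂ ≡ φ₃) ×
        MinInconsistent Γ₀

    _<₀_ : Fm → Fm → Set
    Φ <₀ Ψ = Γ Φ × NegFree Φ × Γ Ψ × NegFree Ψ ×
      Σ FmSet λ Γ₀ → Γ₀ ⊆Γ Γ ×
        MinInconsistent (Γ₀ ∪₂ (Φ , ¬' Ψ)) ×
        Consistent (Γ₀ ∪₂ (¬' Φ , Ψ))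

    StronglyPathConnected : Set
    StronglyPathConnected =
      ∀ Φ Ψ → Γ Φ → NegFree Φ → Γ Ψ → NegFree Ψ → Star _<₀_ Φ Ψ

    ImpossibilityFrame : Set
    ImpossibilityFrame = MinimallyConnected × StronglyPathConnected

module _ (r : ℕ) .{{_ : NonZero r}} where

  ⟦_⟧ : ℕ → Fin r
  ⟦ n ⟧ = n mod r

  _⊕_ : Fin r → Fin r → Fin r
  a ⊕ b = (toℕ a + toℕ b) mod r

  _⊖_ : Fin r → Fin r → Fin r
  a ⊖ b = (toℕ a + (r ∸ toℕ b)) mod r

  Interval : ℕ → ℕ → Fin r → Set
  Interval a b x = Σ ℕ λ i → a ≤ i × i ≤ b × x ≡ ⟦ i ⟧

  KSymmetric : ℕ → Subset r → Set
  KSymmetric k A = ∀ a → a ∈ A → (⟦ k ⟧ ⊖ a) ∈ A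

  -- Frame 1: W = {x} ⊔ ℤ/rℤ  (x = inj₁ tt)
  R₁ : ℕ → Subset r → (⊤ ⊎ Fin r) → (⊤ ⊎ Fin r) → Set
  R₁ k A (inj₁ _) (inj₁ _) = ⊥
  R₁ k A (inj₁ _) (inj₂ a) = a ∈ A
  R₁ k A (inj₂ _) (inj₁ _) = ⊥
  R₁ k A (inj₂ w) (inj₂ v) = v ≡ w ⊕ ⟦ k ⟧

  Frame₁ : ℕ → Subset r → Frame
  Frame₁ k A = record { W = ⊤ ⊎ Fin r ; R = R₁ k A }

  R₂ : Subset r → Fin r → Fin r → Set
  R₂ A w v = Σ (Fin r) λ a → a ∈ A × v ≡ w ⊕ a

  Frame₂ : Subset r → Frame
  Frame₂ A = record { W = Fin r ; R = R₂ A }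

Γ₁ : Fm → Set
Γ₁ φ = Σ ℕ λ j → 1 ≤ j × (φ ≡ □^ j p ⊎ φ ≡ ¬' □^ j p)

Γ₂ : Fm → Set
Γ₂ φ = Σ ℕ λ j → (φ ≡ □◇^ j (□ p) ⊎ φ ≡ ¬' □◇^ j (□ p))

module Submission where

-- Write Φₙ for the n-th negation-free formula of Γ (□^(n+1) p, resp. (□◇)^n □p).  In both frames
-- Φₙ holds at w₀ exactly when the valuation contains the translate A + nk of A in ℤ/r.  Hence
-- {Φₙ | n ∈ L} ∪ {¬Φₜ} is inconsistent iff the translates A + nk, n ∈ L, cover A + tk, and since
-- k is invertible mod r every translate of A is of this form.  A + (i ± 1)k is covered by A + ik
-- together with translates of A + (i ± 1)k by at most k; the formulas of a minimal subcover,
-- with ¬Φ_{i±1}, form a minimally inconsistent set witnessing Φᵢ <₀ Φ_{i±1}.  That Φᵢ belongs to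
-- it, that swapping Φᵢ and Φ_{i±1} restores consistency and that it has a third element is read
-- off the points ik, (i+1)k, (i+2)k, which 3k < r keeps apart.  Chaining the steps i <₀ i ± 1
-- connects any two Φₙ.

open import Defs
open import Data.Nat using (ℕ; _≤_; _<_; _*_; NonZero)
open import Data.Nat.Coprimality using (Coprime)
open import Data.Fin using (Fin; zero)
open import Data.Fin.Subset using (Subset; _∈_)
open import Data.Unit using (tt)
open import Data.Sum using (inj₁)
open import Data.Product using (_×_)

open import Data.Bool using (Bool; true; false)
open import Data.Empty using (⊥-elim)
open import Data.Nat using (zero; suc; pred; _+_; _∸_; _%_; _/_; s≤s; z≤n; >-nonZero⁻¹)
open import Data.Nat.Properties
  using (_≟_; ≤-refl; ≤-reflexive; ≤-trans; ≤-pred; ≤-total; ≤-<-trans; <-≤-trans; <⇒≤; <⇒≱;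
         ≤∧≢⇒<; ≤-<-connex; m≤m+n; m≤n+m; m<n+m; +-mono-≤; +-monoˡ-≤; +-mono-≤-<; +-monoˡ-<;
         +-cancelˡ-<; *-monoˡ-≤; +-assoc; +-comm; +-identityʳ; *-assoc; *-identityʳ; m∸n+n≡m;
         m+[n∸m]≡n; suc-pred; module ≤-Reasoning)
open import Data.Nat.DivMod
  using (m<n⇒m%n≡m; m%n<n; m%n%n≡m%n; n%n≡0; %-distribˡ-+; %-distribˡ-*; m≡m%n+[m/n]*n;
         [m+kn]%n≡m%n)
open import Data.Nat.Coprimality using (coprime-Bézout)
open import Data.Nat.GCD using (module Bézout)
open import Data.Nat.Tactic.RingSolver using (solve-∀)
open import Data.Fin using (toℕ)
open import Data.Fin.Properties
  using (all?; toℕ<n; toℕ-fromℕ<; toℕ-injective) renaming (any? to any-Fin?)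
open import Data.Fin.Subset.Properties using (_∈?_)
open import Data.List using (List; []; _∷_; filter; length; map; upTo)
open import Data.List.Properties using (filter-notAll)
open import Data.List.Relation.Unary.Any using (Any; here; there; any?)
open import Data.List.Membership.Propositional using (find; lose) renaming (_∈_ to _∈ˡ_)
open import Data.List.Membership.Propositional.Properties
  using (∈-filter⁻; ∈-filter⁺; ∈-map⁺; ∈-map⁻; ∈-upTo⁺; ∈-upTo⁻)
open import Data.List.Membership.DecPropositional _≟Fm_ using () renaming (_∈?_ to _∈ᶠ?_)
open import Data.List.Relation.Binary.Subset.Propositional using (_⊆_)
open import Data.List.Relation.Binary.Subset.Propositional.Properties using (filter-⊆; map⁺)
open import Data.Product using (Σ; ∃; _,_; proj₁; proj₂)
open import Data.Sum using (_⊎_; inj₂)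
open import Function using (_∘_)
open import Function.Bundles using (_⇔_; mk⇔; Equivalence)
open import Relation.Binary.Bundles using (Setoid)
import Relation.Binary.Construct.On as On
open import Relation.Binary.PropositionalEquality
  using (_≡_; _≢_; refl; sym; trans; cong; cong₂; subst; setoid; module ≡-Reasoning)
open import Relation.Binary.Construct.Closure.ReflexiveTransitive using (Star; ε; _◅_; _◅◅_)
import Relation.Binary.Reasoning.Setoid
open import Relation.Nullary using (¬_; Dec; yes; no; ¬?; contradiction)
open import Relation.Nullary.Decidable using (⌊_⌋; _→-dec_; _×-dec_)

isYes⇒ : ∀ {P : Set} (P? : Dec P) → ⌊ P? ⌋ ≡ true → P
isYes⇒ (yes x) _ = x

⇒isYes : ∀ {P : Set} (P? : Dec P) → P → ⌊ P? ⌋ ≡ true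
⇒isYes (yes _) _ = refl
⇒isYes (no ¬x) x = contradiction x ¬x

∈-∪₂⁻ : ∀ S {φ ψ χ} → χ ∈ˢ (S ∪₂ (φ , ψ)) → χ ∈ˢ S ⊎ χ ≡ φ ⊎ χ ≡ ψ
∈-∪₂⁻ S {φ} {ψ} {χ} _ with S χ | χ ≟Fm φ | χ ≟Fm ψ
... | true  | _     | _     = inj₁ refl
... | false | yes e | _     = inj₂ (inj₁ e)
... | false | no _  | yes e = inj₂ (inj₂ e)

∈-∪₂⁺ˡ : ∀ S {φ ψ χ} → χ ∈ˢ S → χ ∈ˢ (S ∪₂ (φ , ψ))
∈-∪₂⁺ˡ S {χ = χ} χ∈S with S χ
... | true = refl

∈-∪₂⁺₁ : ∀ S {φ ψ} → φ ∈ˢ (S ∪₂ (φ , ψ))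
∈-∪₂⁺₁ S {φ} with S φ | φ ≟Fm φ
... | true  | _    = refl
... | false | yes _ = refl
... | false | no ¬e = contradiction refl ¬e

∈-∪₂⁺₂ : ∀ S {φ ψ} → ψ ∈ˢ (S ∪₂ (φ , ψ))
∈-∪₂⁺₂ S {φ} {ψ} with S ψ | ψ ≟Fm φ | ψ ≟Fm ψ
... | true  | _     | _     = refl
... | false | yes _ | _     = refl
... | false | no _  | yes _ = refl
... | false | no _  | no ¬e = contradiction refl ¬e

module _ (F : Frame) (w₀ : Frame.W F) where
  open Frame F

  ConsistentWithout : FmSet → Fm → Set
  ConsistentWithout Δ φ = Σ (W → Bool) λ V → ∀ ψ → ψ ∈ˢ Δ → ψ ≢ φ → Sat F V w₀ ψ

  minInconsistent : ∀ {Δ} → Inconsistent F w₀ Δ → (∀ φ → φ ∈ˢ Δ → ConsistentWithout Δ φ) →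
    MinInconsistent F w₀ Δ
  minInconsistent {Δ} inc critical Δ₀ Δ₀⊆Δ = mk⇔ equal inconsistent
    where
    equal : Inconsistent F w₀ Δ₀ → Δ₀ ≐ Δ
    equal inc₀ φ with Δ₀ φ in φ∈Δ₀ | Δ φ in φ∈Δ
    ... | true  | true  = refl
    ... | false | false = refl
    ... | true  | false = trans (sym (Δ₀⊆Δ φ φ∈Δ₀)) φ∈Δ
    ... | false | true  with critical φ φ∈Δ
    ...   | V , sat = ⊥-elim (inc₀ (V , λ ψ ψ∈Δ₀ → sat ψ (Δ₀⊆Δ ψ ψ∈Δ₀) (≢φ ψ∈Δ₀)))
      where
      ≢φ : ∀ {ψ} → ψ ∈ˢ Δ₀ → ψ ≢ φ
      ≢φ ψ∈Δ₀ refl = contradiction (trans (sym φ∈Δ₀) ψ∈Δ₀) λ ()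
    inconsistent : Δ₀ ≐ Δ → Inconsistent F w₀ Δ₀
    inconsistent Δ₀≐Δ (V , sat) = inc (V , λ ψ ψ∈Δ → sat ψ (trans (Δ₀≐Δ ψ) ψ∈Δ))

module Covering {N : ℕ} {pt : ℕ → Fin N → Set} (pt? : ∀ n x → Dec (pt n x)) where

  _∈⋃_ : Fin N → List ℕ → Set
  x ∈⋃ L = Any (λ n → pt n x) L

  _∈⋃?_ : ∀ x L → Dec (x ∈⋃ L)
  x ∈⋃? L = any? (λ n → pt? n x) L

  _Covers_ : List ℕ → ℕ → Set
  L Covers t = ∀ x → pt t x → x ∈⋃ L

  _covers?_ : ∀ L t → Dec (L Covers t)
  L covers? t = all? (λ x → pt? t x →-dec x ∈⋃? L)

  without : ℕ → List ℕ → List ℕ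
  without m = filter (λ n → ¬? (n ≟ m))

  ∈-without⁻ : ∀ {m n L} → n ∈ˡ without m L → n ∈ˡ L × n ≢ m
  ∈-without⁻ {m} = ∈-filter⁻ (λ n → ¬? (n ≟ m))

  ∈-without⁺ : ∀ {m n L} → n ∈ˡ L → n ≢ m → n ∈ˡ without m L
  ∈-without⁺ {m} = ∈-filter⁺ (λ n → ¬? (n ≟ m))

  record MinimalSubcover (L : List ℕ) (t : ℕ) : Set where
    field
      cover     : List ℕ
      cover⊆    : cover ⊆ L
      covers    : cover Covers t
      essential : ∀ {m} → m ∈ˡ cover → ¬ (without m cover Covers t)

  minimalSubcover : ∀ {t} L → L Covers t → MinimalSubcover L t
  minimalSubcover {t} L = shrink L (length L) ≤-refl
    where
    shrink : ∀ L fuel → length L ≤ fuel → L Covers t → MinimalSubcover L t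
    shrink [] _ _ cov = record { cover = [] ; cover⊆ = λ () ; covers = cov ; essential = λ () }
    shrink L@(_ ∷ _) (suc fuel) len cov with any? (λ m → without m L covers? t) L
    ... | no none = record
            { cover = L ; cover⊆ = λ n∈ → n∈ ; covers = cov ; essential = λ m∈ c → none (lose m∈ c) }
    ... | yes some with find some
    ...   | m , m∈L , cov′ = record
            { cover     = cover
            ; cover⊆    = λ n∈ → proj₁ (∈-without⁻ (cover⊆ n∈))
            ; covers    = covers
            ; essential = essential
            }
      where
      shorter : length (without m L) ≤ fuel
      shorter = ≤-pred (≤-trans (filter-notAll (λ n → ¬? (n ≟ m)) L (lose m∈L λ m≢m → m≢m refl)) len)
      open MinimalSubcover (shrink (without m L) fuel shorter cov′)

  -- y forces i into every minimal subcover, z keeps the set with the roles of i and t swapped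
  -- consistent, and w supplies a third formula of the minimally inconsistent set.
  record Step (i t : ℕ) : Set where
    field
      others    : List ℕ
      covers    : (i ∷ others) Covers t
      y         : Fin N
      y∈t       : pt t y
      y∉others  : ∀ {n} → n ∈ˡ others → ¬ pt n y
      z         : Fin N
      z∈i       : pt i z
      z∉t       : ¬ pt t z
      z∉others  : ∀ {n} → n ∈ˡ others → ¬ pt n z
      w         : Fin N
      w∈t       : pt t w
      w∉i       : ¬ pt i w

record PointModel (F : Frame) (w₀ : Frame.W F) (Γ : Fm → Set) {N : ℕ} (pt : ℕ → Fin N → Set) : Set₁ where
  open Frame F
  field
    fm              : ℕ → Fm
    fm-injective    : ∀ {m n} → fm m ≡ fm n → m ≡ n
    fm-negFree      : ∀ n → NegFree (fm n)
    fm∈Γ            : ∀ n → Γ (fm n)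
    ¬fm∈Γ           : ∀ n → Γ (¬' fm n)
    Γ-negFree       : ∀ φ → Γ φ → NegFree φ → ∃ λ n → φ ≡ fm n
    restrict        : (W → Bool) → Fin N → Bool
    extend          : (Fin N → Bool) → W → Bool
    restrict-extend : ∀ U x → restrict (extend U) x ≡ U x
    sat⇔            : ∀ V n → Sat F V w₀ (fm n) ⇔ (∀ x → pt n x → restrict V x ≡ true)

module Impossibility {F : Frame} {w₀ : Frame.W F} {Γ : Fm → Set} {N : ℕ} {pt : ℕ → Fin N → Set}
  (pt? : ∀ n x → Dec (pt n x)) (model : PointModel F w₀ Γ pt) where

  open Frame F
  open PointModel model
  open Covering pt?
  open Equivalence

  fm≢¬' : ∀ n φ → fm n ≢ ¬' φ
  fm≢¬' n φ e = subst NegFree e (fm-negFree n)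

  fmSet : List ℕ → FmSet
  fmSet L φ = ⌊ φ ∈ᶠ? map fm L ⌋

  fmSet⊆Γ : ∀ L → fmSet L ⊆Γ Γ
  fmSet⊆Γ L φ φ∈ with ∈-map⁻ fm (isYes⇒ (φ ∈ᶠ? map fm L) φ∈)
  ... | n , _ , refl = fm∈Γ n

  ⋃ᵛ : List ℕ → W → Bool
  ⋃ᵛ L = extend (λ x → ⌊ x ∈⋃? L ⌋)

  ∈⋃ᵛ⁻ : ∀ {L x} → restrict (⋃ᵛ L) x ≡ true → x ∈⋃ L
  ∈⋃ᵛ⁻ {L} {x} e = isYes⇒ (x ∈⋃? L) (trans (sym (restrict-extend _ x)) e)

  ⋃ᵛ-sat : ∀ {L n} → n ∈ˡ L → Sat F (⋃ᵛ L) w₀ (fm n)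
  ⋃ᵛ-sat {L} {n} n∈L = from (sat⇔ (⋃ᵛ L) n) λ x x∈n →
    trans (restrict-extend _ x) (⇒isYes (x ∈⋃? L) (lose n∈L x∈n))

  ⋃ᵛ-unsat : ∀ {L t} → ¬ (L Covers t) → ¬ Sat F (⋃ᵛ L) w₀ (fm t)
  ⋃ᵛ-unsat {L} {t} ¬cov sat = ¬cov λ x x∈t → ∈⋃ᵛ⁻ (to (sat⇔ (⋃ᵛ L) t) sat x x∈t)

  covered⇒sat : ∀ {L t} V → L Covers t → (∀ {n} → n ∈ˡ L → Sat F V w₀ (fm n)) → Sat F V w₀ (fm t)
  covered⇒sat {L} {t} V cov sat = from (sat⇔ V t) λ x x∈t →
    let n , n∈L , x∈n = find (cov x x∈t) in to (sat⇔ V n) (sat n∈L) x x∈n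

  module _ {i t : ℕ} (step : Step i t) where
    open Step step using (others; y; y∈t; y∉others; z; z∈i; z∉t; z∉others; w; w∈t; w∉i)
    open MinimalSubcover (minimalSubcover (i ∷ others) (Step.covers step))

    ∈-others : ∀ {n} → n ∈ˡ cover → n ≢ i → n ∈ˡ others
    ∈-others n∈ n≢i with cover⊆ n∈
    ... | here n≡i = contradiction n≡i n≢i
    ... | there n∈others = n∈others

    i∈cover : i ∈ˡ cover
    i∈cover with find (covers y y∈t)
    ... | n , n∈ , y∈n with n ≟ i
    ...   | yes refl = n∈
    ...   | no n≢i = contradiction y∈n (y∉others (∈-others n∈ n≢i))

    Γ₀ : FmSet
    Γ₀ = fmSet (without i cover)

    Δ : FmSet
    Δ = Γ₀ ∪₂ (fm i , ¬' fm t)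

    ∈Δ⁻ : ∀ {φ} → φ ∈ˢ Δ → φ ∈ˡ map fm cover ⊎ φ ≡ ¬' fm t
    ∈Δ⁻ {φ} φ∈ with ∈-∪₂⁻ Γ₀ φ∈
    ... | inj₁ φ∈Γ₀ = inj₁ (map⁺ fm (filter-⊆ _ cover) (isYes⇒ (φ ∈ᶠ? _) φ∈Γ₀))
    ... | inj₂ (inj₁ refl) = inj₁ (∈-map⁺ fm i∈cover)
    ... | inj₂ (inj₂ refl) = inj₂ refl

    fm∈Δ : ∀ {n} → n ∈ˡ cover → fm n ∈ˢ Δ
    fm∈Δ {n} n∈ with n ≟ i
    ... | yes refl = ∈-∪₂⁺₁ Γ₀
    ... | no n≢i = ∈-∪₂⁺ˡ Γ₀ (⇒isYes (fm n ∈ᶠ? _) (∈-map⁺ fm (∈-without⁺ n∈ n≢i)))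

    Δ-inconsistent : Inconsistent F w₀ Δ
    Δ-inconsistent (V , sat) =
      sat (¬' fm t) (∈-∪₂⁺₂ Γ₀) (covered⇒sat V covers λ n∈ → sat _ (fm∈Δ n∈))

    Δ-critical : ∀ φ → φ ∈ˢ Δ → ConsistentWithout F w₀ Δ φ
    Δ-critical φ φ∈ with ∈Δ⁻ φ∈
    ... | inj₂ refl = extend (λ _ → true) , λ ψ ψ∈ ψ≢φ → all-true ψ (∈Δ⁻ ψ∈) ψ≢φ
      where
      all-true : ∀ ψ → ψ ∈ˡ map fm cover ⊎ ψ ≡ ¬' fm t → ψ ≢ ¬' fm t → Sat F (extend (λ _ → true)) w₀ ψ
      all-true ψ (inj₁ ψ∈) _ with ∈-map⁻ fm ψ∈
      ... | n , _ , refl = from (sat⇔ _ n) λ x _ → restrict-extend _ x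
      all-true ψ (inj₂ ψ≡) ψ≢ = contradiction ψ≡ ψ≢
    ... | inj₁ φ∈ₘ with ∈-map⁻ fm φ∈ₘ
    ...   | m , m∈ , refl = ⋃ᵛ (without m cover) , λ ψ ψ∈ ψ≢fm → all-but-m ψ (∈Δ⁻ ψ∈) ψ≢fm
      where
      all-but-m : ∀ ψ → ψ ∈ˡ map fm cover ⊎ ψ ≡ ¬' fm t → ψ ≢ fm m → Sat F (⋃ᵛ (without m cover)) w₀ ψ
      all-but-m ψ (inj₁ ψ∈) ψ≢ with ∈-map⁻ fm ψ∈
      ... | n , n∈ , refl = ⋃ᵛ-sat (∈-without⁺ n∈ λ n≡m → ψ≢ (cong fm n≡m))
      all-but-m ψ (inj₂ refl) _ = ⋃ᵛ-unsat (essential m∈)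

    Δ-minInconsistent : MinInconsistent F w₀ Δ
    Δ-minInconsistent = minInconsistent F w₀ Δ-inconsistent Δ-critical

    -- The union of the other point sets misses z ∈ pt i.
    swapped-consistent : Consistent F w₀ (Γ₀ ∪₂ (¬' fm i , fm t))
    swapped-consistent = ⋃ᵛ (t ∷ without i cover) , λ ψ ψ∈ → sat ψ (∈-∪₂⁻ Γ₀ ψ∈)
      where
      sat : ∀ ψ → ψ ∈ˢ Γ₀ ⊎ ψ ≡ ¬' fm i ⊎ ψ ≡ fm t → Sat F (⋃ᵛ (t ∷ without i cover)) w₀ ψ
      sat ψ (inj₁ ψ∈Γ₀) with ∈-map⁻ fm (isYes⇒ (ψ ∈ᶠ? _) ψ∈Γ₀)
      ... | n , n∈ , refl = ⋃ᵛ-sat (there n∈)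
      sat ψ (inj₂ (inj₂ refl)) = ⋃ᵛ-sat (here refl)
      sat ψ (inj₂ (inj₁ refl)) fm-i with find (∈⋃ᵛ⁻ (to (sat⇔ _ i) fm-i z z∈i))
      ... | _ , here refl , z∈t = z∉t z∈t
      ... | _ , there n∈ , z∈n with ∈-without⁻ n∈
      ...   | n∈cover , n≢i = z∉others (∈-others n∈cover n≢i) z∈n

    step⇒<₀ : _<₀_ F w₀ Γ (fm i) (fm t)
    step⇒<₀ = fm∈Γ i , fm-negFree i , fm∈Γ t , fm-negFree t ,
      Γ₀ , fmSet⊆Γ (without i cover) , Δ-minInconsistent , swapped-consistent

    step⇒minimallyConnected : MinimallyConnected F w₀ Γ
    step⇒minimallyConnected with find (covers w w∈t)
    ... | m , m∈ , w∈m = Δ , Δ⊆Γ ,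
      (fm i , fm m , ¬' fm t , ∈-∪₂⁺₁ Γ₀ , fm∈Δ m∈ , ∈-∪₂⁺₂ Γ₀ ,
       (λ e → w∉i (subst (λ n → pt n w) (sym (fm-injective e)) w∈m)) , fm≢¬' i (fm t) , fm≢¬' m (fm t)) ,
      Δ-minInconsistent
      where
      Δ⊆Γ : Δ ⊆Γ Γ
      Δ⊆Γ ψ ψ∈ with ∈Δ⁻ ψ∈
      ... | inj₁ ψ∈ₘ with ∈-map⁻ fm ψ∈ₘ
      ...   | n , _ , refl = fm∈Γ n
      Δ⊆Γ ψ ψ∈ | inj₂ refl = ¬fm∈Γ t

  impossibilityFrame : (∀ i → Step i (suc i)) → (∀ i → Step (suc i) i) → ImpossibilityFrame F w₀ Γ
  impossibilityFrame up down = step⇒minimallyConnected (up 0) , pathConnected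
    where
    _⇝_ : ℕ → ℕ → Set
    m ⇝ n = Star (_<₀_ F w₀ Γ) (fm m) (fm n)

    ascend : ∀ m d → m ⇝ (d + m)
    ascend m zero = ε
    ascend m (suc d) = ascend m d ◅◅ (step⇒<₀ (up (d + m)) ◅ ε)

    descend : ∀ m d → (d + m) ⇝ m
    descend m zero = ε
    descend m (suc d) = step⇒<₀ (down (d + m)) ◅ descend m d

    chain : ∀ m n → m ⇝ n
    chain m n with ≤-total m n
    ... | inj₁ m≤n = subst (m ⇝_) (m∸n+n≡m m≤n) (ascend m (n ∸ m))
    ... | inj₂ n≤m = subst (_⇝ n) (m∸n+n≡m n≤m) (descend n (m ∸ n))

    pathConnected : StronglyPathConnected F w₀ Γ
    pathConnected Φ Ψ ΓΦ Φ-nf ΓΨ Ψ-nf with Γ-negFree Φ ΓΦ Φ-nf | Γ-negFree Ψ ΓΨ Ψ-nf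
    ... | m , refl | n , refl = chain m n

module Residues (r : ℕ) .{{_ : NonZero r}} where

  infix 4 _≈_
  _≈_ : ℕ → ℕ → Set
  m ≈ n = m % r ≡ n % r

  ≈-setoid : Setoid _ _
  ≈-setoid = On.setoid (setoid ℕ) (_% r)

  module ≈-Reasoning = Relation.Binary.Reasoning.Setoid ≈-setoid

  [_] : ℕ → Fin r
  [ m ] = ⟦_⟧ r m

  infixl 6 _⊞_ _⊟_
  _⊞_ _⊟_ : Fin r → Fin r → Fin r
  _⊞_ = _⊕_ r
  _⊟_ = _⊖_ r

  ≡⇒≈ : ∀ {m n} → m ≡ n → m ≈ n
  ≡⇒≈ = cong (_% r)

  +-cong : ∀ {m m′ n n′} → m ≈ m′ → n ≈ n′ → m + n ≈ m′ + n′
  +-cong {m} {m′} {n} {n′} m≈m′ n≈n′ = begin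
    (m + n) % r               ≡⟨ %-distribˡ-+ m n r ⟩
    (m % r + n % r) % r       ≡⟨ cong₂ (λ a b → (a + b) % r) m≈m′ n≈n′ ⟩
    (m′ % r + n′ % r) % r     ≡⟨ %-distribˡ-+ m′ n′ r ⟨
    (m′ + n′) % r             ∎
    where open ≡-Reasoning

  *-congˡ : ∀ m {n n′} → n ≈ n′ → m * n ≈ m * n′
  *-congˡ m {n} {n′} n≈n′ = begin
    (m * n) % r               ≡⟨ %-distribˡ-* m n r ⟩
    (m % r * (n % r)) % r     ≡⟨ cong (λ b → (m % r * b) % r) n≈n′ ⟩
    (m % r * (n′ % r)) % r    ≡⟨ %-distribˡ-* m n′ r ⟨
    (m * n′) % r              ∎
    where open ≡-Reasoning

  r≈0 : r ≈ 0
  r≈0 = trans (n%n≡0 r) (sym (m<n⇒m%n≡m (>-nonZero⁻¹ r)))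

  toℕ-mod : ∀ m → toℕ [ m ] ≈ m
  toℕ-mod m = trans (≡⇒≈ (toℕ-fromℕ< (m%n<n m r))) (m%n%n≡m%n m r)

  toℕ-mod< : ∀ {m} → m < r → toℕ [ m ] ≡ m
  toℕ-mod< {m} m<r = trans (toℕ-fromℕ< (m%n<n m r)) (m<n⇒m%n≡m m<r)

  toℕ-≈-injective : ∀ {x y : Fin r} → toℕ x ≈ toℕ y → x ≡ y
  toℕ-≈-injective {x} {y} x≈y =
    toℕ-injective (trans (sym (m<n⇒m%n≡m (toℕ<n x))) (trans x≈y (m<n⇒m%n≡m (toℕ<n y))))

  ≉-within : ∀ {m n} → m < n → n < m + r → ¬ n ≈ m
  ≉-within {m} {n} m<n n<m+r n≈m with ≤-<-connex (n / r) (m / r)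
  ... | inj₁ n/r≤m/r = <⇒≱ m<n (begin
    n                      ≡⟨ m≡m%n+[m/n]*n n r ⟩
    n % r + (n / r) * r    ≤⟨ +-mono-≤ (≤-reflexive n≈m) (*-monoˡ-≤ r n/r≤m/r) ⟩
    m % r + (m / r) * r    ≡⟨ m≡m%n+[m/n]*n m r ⟨
    m                      ∎)
    where open ≤-Reasoning
  ... | inj₂ m/r<n/r = <⇒≱ n<m+r (begin
    m + r                      ≡⟨ cong (_+ r) (m≡m%n+[m/n]*n m r) ⟩
    m % r + (m / r) * r + r    ≡⟨ +-assoc (m % r) _ r ⟩
    m % r + ((m / r) * r + r)  ≡⟨ cong (m % r +_) (+-comm _ r) ⟩
    m % r + suc (m / r) * r    ≤⟨ +-mono-≤ (≤-reflexive (sym n≈m)) (*-monoˡ-≤ r m/r<n/r) ⟩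
    n % r + (n / r) * r        ≡⟨ m≡m%n+[m/n]*n n r ⟨
    n                          ∎)
    where open ≤-Reasoning

  inverse : ∀ {k} → Coprime r k → ∃ λ u → u * k ≈ 1
  inverse {k} r⊥k with coprime-Bézout r⊥k
  ... | Bézout.Identity.-+ x y 1+xr≡yk = y , (begin
    y * k       ≡⟨ 1+xr≡yk ⟨
    1 + x * r   ≈⟨ [m+kn]%n≡m%n 1 x r ⟩
    1           ∎)
    where open ≈-Reasoning
  ... | Bézout.Identity.+- x y 1+yk≡xr = q * y , (begin
    q * y * k              ≈⟨ [m+kn]%n≡m%n (q * y * k) 1 r ⟨
    q * y * k + 1 * r      ≡⟨ cong (λ n → q * y * k + 1 * n) (suc-pred r) ⟨
    q * y * k + 1 * suc q  ≡⟨ regroup q y k ⟩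
    1 + q * (1 + y * k)    ≡⟨ cong (λ n → 1 + q * n) 1+yk≡xr ⟩
    1 + q * (x * r)        ≡⟨ cong (1 +_) (*-assoc q x r) ⟨
    1 + q * x * r          ≈⟨ [m+kn]%n≡m%n 1 (q * x) r ⟩
    1                      ∎)
    where
    open ≈-Reasoning
    q = pred r
    regroup : ∀ q y k → q * y * k + 1 * suc q ≡ 1 + q * (1 + y * k)
    regroup = solve-∀

  +-cancelʳ-≈ : ∀ X {m n} → m + X ≈ n + X → m ≈ n
  +-cancelʳ-≈ X {m} {n} m+X≈n+X = begin
    m                      ≈⟨ [m+kn]%n≡m%n m X r ⟨
    m + X * r              ≡⟨ cong (λ n → m + X * n) (suc-pred r) ⟨
    m + X * suc (pred r)   ≡⟨ regroup m X (pred r) ⟩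
    (m + X) + X * pred r   ≈⟨ +-cong m+X≈n+X refl ⟩
    (n + X) + X * pred r   ≡⟨ regroup n X (pred r) ⟨
    n + X * suc (pred r)   ≡⟨ cong (λ m → n + X * m) (suc-pred r) ⟩
    n + X * r              ≈⟨ [m+kn]%n≡m%n n X r ⟩
    n                      ∎
    where
    open ≈-Reasoning
    regroup : ∀ m X q → m + X * suc q ≡ (m + X) + X * q
    regroup = solve-∀

  Apart : ℕ → ℕ → Set
  Apart d e = (d < e × e < d + r) ⊎ (e < d × d < e + r)

  apart⇒≉ : ∀ {d e} → Apart d e → ¬ d ≈ e
  apart⇒≉ (inj₁ (d<e , e<d+r)) d≈e = ≉-within d<e e<d+r (sym d≈e)
  apart⇒≉ (inj₂ (e<d , d<e+r)) d≈e = ≉-within e<d d<e+r d≈e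

module Translates (r k : ℕ) .{{_ : NonZero r}} (A : Subset r) where
  open Residues r

  infix 4 _∈A+_ _∈A+?_
  _∈A+_ : Fin r → ℕ → Set
  x ∈A+ m = ∃ λ a → a ∈ A × toℕ x ≈ toℕ a + m

  _∈A+?_ : ∀ x m → Dec (x ∈A+ m)
  x ∈A+? m = any-Fin? λ a → (a ∈? A) ×-dec (toℕ x % r ≟ (toℕ a + m) % r)

  ∈A+-resp : ∀ {x m m′} → m ≈ m′ → x ∈A+ m → x ∈A+ m′
  ∈A+-resp m≈m′ (a , a∈A , x≈) = a , a∈A , trans x≈ (+-cong refl m≈m′)

  Translate : ℕ → Fin r → Set
  Translate n x = x ∈A+ n * k

  Translate? : ∀ n x → Dec (Translate n x)
  Translate? n x = x ∈A+? n * k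

module Steps (r k : ℕ) .{{_ : NonZero r}} (r⊥k : Coprime r k) (1≤k : 1 ≤ k) (3k<r : 3 * k < r)
  (A : Subset r) (0∈A : ⟦_⟧ r 0 ∈ A) (k∈A : ⟦_⟧ r k ∈ A) (A⊆[0,k] : ∀ a → a ∈ A → Interval r 0 k a) where

  open Residues r
  open Translates r k A
  open Covering Translate?

  k+[k+k]<r : k + (k + k) < r
  k+[k+k]<r = subst (λ n → k + (k + n) < r) (+-identityʳ k) 3k<r

  k+k<r : k + k < r
  k+k<r = ≤-<-trans (m≤n+m (k + k) k) k+[k+k]<r

  k<r : k < r
  k<r = ≤-<-trans (m≤n+m k k) k+k<r

  a≤k : ∀ {a} → a ∈ A → toℕ a ≤ k
  a≤k {a} a∈A with A⊆[0,k] a a∈A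
  ... | i , _ , i≤k , refl = subst (_≤ k) (sym (toℕ-mod< (≤-<-trans i≤k k<r))) i≤k

  u : ℕ
  u = inverse r⊥k .proj₁

  index : ℕ → ℕ
  index m = u * m

  index-k : ∀ m → index m * k ≈ m
  index-k m = begin
    u * m * k     ≡⟨ swap u m k ⟩
    m * (u * k)   ≈⟨ *-congˡ m (inverse r⊥k .proj₂) ⟩
    m * 1         ≡⟨ *-identityʳ m ⟩
    m             ∎
    where
    open ≈-Reasoning
    swap : ∀ u m k → u * m * k ≡ m * (u * k)
    swap = solve-∀

  Translate-index⁺ : ∀ {x m} → x ∈A+ m → Translate (index m) x
  Translate-index⁺ {m = m} = ∈A+-resp (sym (index-k m))

  Translate-index⁻ : ∀ {x m} → Translate (index m) x → x ∈A+ m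
  Translate-index⁻ {m = m} = ∈A+-resp (index-k m)

  ∈A+-via : ∀ {a x m} → a < r → [ a ] ∈ A → toℕ x ≈ a + m → x ∈A+ m
  ∈A+-via {m = m} a<r a∈A x≈a+m = [ _ ] , a∈A , trans x≈a+m (≡⇒≈ (cong (_+ m) (sym (toℕ-mod< a<r))))

  ∈A+-via-0 : ∀ {x m} → toℕ x ≈ m → x ∈A+ m
  ∈A+-via-0 = ∈A+-via (≤-<-trans z≤n k<r) 0∈A

  ∈A+-via-k : ∀ {x m} → toℕ x ≈ k + m → x ∈A+ m
  ∈A+-via-k = ∈A+-via k<r k∈A

  ∉A+ : ∀ {x} e c X → toℕ x ≈ e + X → (∀ a → a ≤ k → Apart (a + c) e) → ¬ x ∈A+ c + X
  ∉A+ {x} e c X x≈e+X apart (a , a∈A , x≈) =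
    apart⇒≉ (apart (toℕ a) (a≤k a∈A)) (+-cancelʳ-≈ X (begin
      toℕ a + c + X     ≡⟨ +-assoc (toℕ a) c X ⟩
      toℕ a + (c + X)   ≈⟨ x≈ ⟨
      toℕ x             ≈⟨ x≈e+X ⟩
      e + X             ∎))
    where open ≈-Reasoning

  -- s plays the role of −k.
  s : ℕ
  s = r ∸ k

  k+s≡r : k + s ≡ r
  k+s≡r = m+[n∸m]≡n (<⇒≤ k<r)

  k+k<s : k + k < s
  k+k<s = +-cancelˡ-< k (k + k) s (subst (k + (k + k) <_) (sym k+s≡r) k+[k+k]<r)

  k<s : k < s
  k<s = ≤-<-trans (m≤m+n k k) k+k<s

  apart-k : ∀ a → a ≤ k → Apart (a + k) 0
  apart-k a a≤k = inj₂ (≤-trans 1≤k (m≤n+m k a) , ≤-<-trans (+-monoˡ-≤ k a≤k) k+k<r)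

  apart-2k : ∀ a → a ≤ k → Apart (a + 0) (k + k)
  apart-2k a a≤k rewrite +-identityʳ a = inj₁ (≤-<-trans a≤k (m<n+m k 1≤k) , ≤-trans k+k<r (m≤n+m r a))

  forward-window : ∀ {a j} → a ≤ k → j < k → k < a + (suc j + k) × a + (suc j + k) < r
  forward-window {a} {j} a≤k j<k =
    ≤-trans (m<n+m k (s≤s z≤n)) (m≤n+m (suc j + k) a) ,
    ≤-<-trans (+-mono-≤ a≤k (+-monoˡ-≤ k j<k)) k+[k+k]<r

  backward-window : ∀ {a j} → a ≤ k → j < k → s ≤ a + (j + s) × a + (j + s) < k + r
  backward-window {a} {j} a≤k j<k =
    ≤-trans (m≤n+m s j) (m≤n+m (j + s) a) ,
    subst (a + (j + s) <_) (cong (k +_) k+s≡r) (+-mono-≤-< a≤k (+-monoˡ-< s j<k))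

  shiftIndices : (ℕ → ℕ) → List ℕ
  shiftIndices shift = map (λ j → index (shift j)) (upTo k)

  ∉shiftIndices : ∀ {shift x n} → (∀ {j} → j < k → ¬ x ∈A+ shift j) → n ∈ˡ shiftIndices shift → ¬ Translate n x
  ∉shiftIndices ∉shift n∈ with ∈-map⁻ _ n∈
  ... | j , j∈ , refl = λ x∈ → ∉shift (∈-upTo⁻ j∈) (Translate-index⁻ x∈)

  ∈⋃-shiftIndices : ∀ {shift x j} i → j < k → x ∈A+ shift j → x ∈⋃ (i ∷ shiftIndices shift)
  ∈⋃-shiftIndices i j<k x∈ = there (lose (∈-map⁺ _ (∈-upTo⁺ j<k)) (Translate-index⁺ x∈))

  -- A + (i+1)k ⊆ (A + ik) ∪ ⋃_{0<b≤k} (A + b + (i+1)k): the point 0 + (i+1)k is k + ik.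
  forward : ∀ i → Step i (suc i)
  forward i = record
    { others = shiftIndices shift
    ; covers = covers
    ; y = [ k + X ]
    ; y∈t = ∈A+-via-0 (toℕ-mod (k + X))
    ; y∉others = ∉shiftIndices λ j<k → ∉A+ k _ X (toℕ-mod (k + X)) λ a a≤k →
        let k<d , d<r = forward-window a≤k j<k in inj₂ (k<d , ≤-trans d<r (m≤n+m r k))
    ; z = [ X ]
    ; z∈i = ∈A+-via-0 (toℕ-mod X)
    ; z∉t = ∉A+ 0 k X (toℕ-mod X) apart-k
    ; z∉others = ∉shiftIndices λ j<k → ∉A+ 0 _ X (toℕ-mod X) λ a a≤k →
        let k<d , d<r = forward-window a≤k j<k in inj₂ (≤-<-trans z≤n k<d , d<r)
    ; w = [ k + (k + X) ]
    ; w∈t = ∈A+-via-k (toℕ-mod (k + (k + X)))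
    ; w∉i = ∉A+ (k + k) 0 X (trans (toℕ-mod _) (≡⇒≈ (sym (+-assoc k k X)))) apart-2k
    }
    where
    X : ℕ
    X = i * k
    shift : ℕ → ℕ
    shift j = suc j + k + X
    covers : (i ∷ shiftIndices shift) Covers suc i
    covers x (a , a∈A , x≈) with toℕ a | a≤k a∈A
    ... | zero  | _   = here (∈A+-via-k x≈)
    ... | suc j | j<k =
      ∈⋃-shiftIndices i j<k (∈A+-via-0 (trans x≈ (≡⇒≈ (sym (+-assoc (suc j) k X)))))

  k+[j+s+X]≈j+X : ∀ j X → k + (j + s + X) ≈ j + X
  k+[j+s+X]≈j+X j X = begin
    k + (j + s + X)   ≡⟨ regroup k j s X ⟩
    j + X + (k + s)   ≡⟨ cong (j + X +_) k+s≡r ⟩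
    j + X + r         ≈⟨ +-cong {j + X} refl r≈0 ⟩
    j + X + 0         ≡⟨ +-identityʳ (j + X) ⟩
    j + X             ∎
    where
    open ≈-Reasoning
    regroup : ∀ k j s X → k + (j + s + X) ≡ j + X + (k + s)
    regroup = solve-∀

  -- A + ik ⊆ (A + (i+1)k) ∪ ⋃_{0≤j<k} (A + j − k + ik): the point k + ik is 0 + (i+1)k.
  backward : ∀ i → Step (suc i) i
  backward i = record
    { others = shiftIndices shift
    ; covers = covers
    ; y = [ k + X ]
    ; y∈t = ∈A+-via-k (toℕ-mod (k + X))
    ; y∉others = ∉shiftIndices λ j<k → ∉A+ k _ X (toℕ-mod (k + X)) λ a a≤k →
        let s≤d , d<k+r = backward-window a≤k j<k in inj₂ (<-≤-trans k<s s≤d , d<k+r)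
    ; z = [ k + (k + X) ]
    ; z∈i = ∈A+-via-k (toℕ-mod (k + (k + X)))
    ; z∉t = ∉A+ (k + k) 0 X z≈ apart-2k
    ; z∉others = ∉shiftIndices λ j<k → ∉A+ (k + k) _ X z≈ λ a a≤k →
        let s≤d , d<k+r = backward-window a≤k j<k
        in  inj₂ (<-≤-trans k+k<s s≤d , ≤-trans d<k+r (+-monoˡ-≤ r (m≤m+n k k)))
    ; w = [ X ]
    ; w∈t = ∈A+-via-0 (toℕ-mod X)
    ; w∉i = ∉A+ 0 k X (toℕ-mod X) apart-k
    }
    where
    X : ℕ
    X = i * k
    shift : ℕ → ℕ
    shift j = j + s + X
    z≈ : toℕ [ k + (k + X) ] ≈ k + k + X
    z≈ = trans (toℕ-mod _) (≡⇒≈ (sym (+-assoc k k X)))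
    covers : (suc i ∷ shiftIndices shift) Covers i
    covers x (a , a∈A , x≈) with toℕ a ≟ k
    ... | yes a≡k = here (∈A+-via-0 (trans x≈ (≡⇒≈ (cong (_+ X) a≡k))))
    ... | no a≢k  =
      ∈⋃-shiftIndices (suc i) (≤∧≢⇒< (a≤k a∈A) a≢k) (∈A+-via-k (trans x≈ (sym (k+[j+s+X]≈j+X (toℕ a) X))))

□^-negFree : ∀ {φ} n → NegFree φ → NegFree (□^ n φ)
□^-negFree zero    φ-nf = φ-nf
□^-negFree (suc n) φ-nf = □^-negFree n φ-nf

□◇^-negFree : ∀ {φ} n → NegFree φ → NegFree (□◇^ n φ)
□◇^-negFree zero    φ-nf = φ-nf
□◇^-negFree (suc n) φ-nf = □◇^-negFree n φ-nf

body : Fm → Fm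
body p      = p
body (□ φ)  = φ
body (◇ φ)  = φ
body (¬' φ) = φ

□^-injective : ∀ {m n} → □^ m p ≡ □^ n p → m ≡ n
□^-injective {zero}  {zero}  _  = refl
□^-injective {suc m} {suc n} eq = cong suc (□^-injective (cong body eq))

□◇^-injective : ∀ {m n} → □◇^ m (□ p) ≡ □◇^ n (□ p) → m ≡ n
□◇^-injective {zero}  {zero}  _  = refl
□◇^-injective {suc m} {suc n} eq = cong suc (□◇^-injective (cong (body ∘ body) eq))

module Frame₁Semantics (r k : ℕ) .{{_ : NonZero r}} (A : Subset r) where
  open Residues r
  open Translates r k A
  open Equivalence

  F₁ : Frame
  F₁ = Frame₁ r k A

  HoldsAt : (Fin r → Bool) → ℕ → Set
  HoldsAt U m = ∀ x → toℕ x ≈ m → U x ≡ true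

  HoldsAt-resp : ∀ {U m m′} → m ≈ m′ → HoldsAt U m → HoldsAt U m′
  HoldsAt-resp m≈m′ h x x≈m′ = h x (trans x≈m′ (sym m≈m′))

  □^-sat : ∀ V n w → Sat F₁ V (inj₂ w) (□^ n p) ⇔ HoldsAt (V ∘ inj₂) (toℕ w + n * k)
  □^-sat V zero w = mk⇔
    (λ Vw x x≈ → subst (λ v → V (inj₂ v) ≡ true) (toℕ-≈-injective (sym (trans x≈ w+0≈w))) Vw)
    (λ h → h w (sym w+0≈w))
    where
    w+0≈w : toℕ w + 0 ≈ toℕ w
    w+0≈w = ≡⇒≈ (+-identityʳ (toℕ w))
  □^-sat V (suc n) w = mk⇔
    (λ sat → HoldsAt-resp w′-shift (to (□^-sat V n w′) (sat (inj₂ w′) refl)))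
    (λ h → λ { (inj₁ _) () ; (inj₂ _) refl → from (□^-sat V n w′) (HoldsAt-resp (sym w′-shift) h) })
    where
    w′ = w ⊞ [ k ]
    w′-shift : toℕ w′ + n * k ≈ toℕ w + (k + n * k)
    w′-shift = begin
      toℕ w′ + n * k               ≈⟨ +-cong (toℕ-mod (toℕ w + toℕ [ k ])) refl ⟩
      toℕ w + toℕ [ k ] + n * k    ≈⟨ +-cong (+-cong {toℕ w} refl (toℕ-mod k)) refl ⟩
      toℕ w + k + n * k            ≡⟨ +-assoc (toℕ w) k (n * k) ⟩
      toℕ w + (k + n * k)          ∎
      where open ≈-Reasoning

  frame₁-sat : ∀ V n → Sat F₁ V (inj₁ tt) (□^ (suc n) p) ⇔ (∀ x → Translate n x → V (inj₂ x) ≡ true)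
  frame₁-sat V n = mk⇔
    (λ sat x (a , a∈A , x≈) → to (□^-sat V n a) (sat (inj₂ a) a∈A) x x≈)
    (λ h → λ { (inj₁ _) () ; (inj₂ a) a∈A → from (□^-sat V n a) λ x x≈ → h x (a , a∈A , x≈) })

  Γ₁-negFree : ∀ φ → Γ₁ φ → NegFree φ → ∃ λ n → φ ≡ □^ (suc n) p
  Γ₁-negFree φ (suc j , _ , inj₁ refl) _ = j , refl
  Γ₁-negFree φ (suc j , _ , inj₂ refl) ()

  frame₁-model : PointModel F₁ (inj₁ tt) Γ₁ Translate
  frame₁-model = record
    { fm              = λ n → □^ (suc n) p
    ; fm-injective    = λ eq → cong pred (□^-injective eq)
    ; fm-negFree      = λ n → □^-negFree (suc n) tt
    ; fm∈Γ            = λ n → suc n , s≤s z≤n , inj₁ refl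
    ; ¬fm∈Γ           = λ n → suc n , s≤s z≤n , inj₂ refl
    ; Γ-negFree       = Γ₁-negFree
    ; restrict        = λ V → V ∘ inj₂
    ; extend          = λ U → λ { (inj₁ _) → false ; (inj₂ x) → U x }
    ; restrict-extend = λ _ _ → refl
    ; sat⇔            = frame₁-sat
    }

module Frame₂Semantics (r k : ℕ) .{{_ : NonZero r}} (A : Subset r) (k-symmetric : KSymmetric r k A) where
  open Residues r
  open Translates r k A
  open Equivalence

  F₂ : Frame
  F₂ = Frame₂ r A

  toℕ-⊞ : ∀ w a → toℕ (w ⊞ a) ≈ toℕ w + toℕ a
  toℕ-⊞ w a = toℕ-mod (toℕ w + toℕ a)

  ⊟-cancel : ∀ a → toℕ ([ k ] ⊟ a) + toℕ a ≈ k
  ⊟-cancel a = begin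
    toℕ ([ k ] ⊟ a) + toℕ a           ≈⟨ +-cong (toℕ-mod (toℕ [ k ] + (r ∸ toℕ a))) refl ⟩
    toℕ [ k ] + (r ∸ toℕ a) + toℕ a   ≡⟨ +-assoc (toℕ [ k ]) (r ∸ toℕ a) (toℕ a) ⟩
    toℕ [ k ] + (r ∸ toℕ a + toℕ a)   ≡⟨ cong (toℕ [ k ] +_) (m∸n+n≡m (<⇒≤ (toℕ<n a))) ⟩
    toℕ [ k ] + r                     ≈⟨ +-cong (toℕ-mod k) r≈0 ⟩
    k + 0                             ≡⟨ +-identityʳ k ⟩
    k                                 ∎
    where open ≈-Reasoning

  ⊞-⊟-cancel : ∀ v a m → toℕ ([ k ] ⊟ a) + (toℕ (v ⊞ a) + m) ≈ toℕ v + (k + m)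
  ⊞-⊟-cancel v a m = begin
    c + (toℕ (v ⊞ a) + m)     ≈⟨ +-cong {c} refl (+-cong (toℕ-⊞ v a) refl) ⟩
    c + (toℕ v + toℕ a + m)   ≡⟨ regroup c (toℕ v) (toℕ a) m ⟩
    toℕ v + (c + toℕ a + m)   ≈⟨ +-cong {toℕ v} refl (+-cong (⊟-cancel a) refl) ⟩
    toℕ v + (k + m)           ∎
    where
    open ≈-Reasoning
    c = toℕ ([ k ] ⊟ a)
    regroup : ∀ c v a m → c + (v + a + m) ≡ v + (c + a + m)
    regroup = solve-∀

  ⊟-⊞-cancel : ∀ w b → toℕ (w ⊞ b ⊞ ([ k ] ⊟ b)) ≈ toℕ w + k
  ⊟-⊞-cancel w b = begin
    toℕ (w ⊞ b ⊞ ([ k ] ⊟ b))   ≈⟨ toℕ-⊞ (w ⊞ b) ([ k ] ⊟ b) ⟩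
    toℕ (w ⊞ b) + c             ≈⟨ +-cong (toℕ-⊞ w b) refl ⟩
    toℕ w + toℕ b + c           ≡⟨ regroup (toℕ w) (toℕ b) c ⟩
    toℕ w + (c + toℕ b)         ≈⟨ +-cong {toℕ w} refl (⊟-cancel b) ⟩
    toℕ w + k                   ∎
    where
    open ≈-Reasoning
    c = toℕ ([ k ] ⊟ b)
    regroup : ∀ w b c → w + b + c ≡ w + (c + b)
    regroup = solve-∀

  -- The ◇-step answering a □-step by a uses k ⊟ a ∈ A, so that each round □◇ advances by k.
  □◇^-sat : ∀ V n w → Sat F₂ V w (□◇^ n (□ p)) ⇔ (∀ x → x ∈A+ toℕ w + n * k → V x ≡ true)
  □◇^-sat V zero w = mk⇔
    (λ sat x (a , a∈A , x≈) → sat x (a , a∈A , toℕ-≈-injective (trans x≈ (sym (toℕ-w⊞ a)))))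
    (λ h → λ { _ (a , a∈A , refl) → h _ (a , a∈A , toℕ-w⊞ a) })
    where
    toℕ-w⊞ : ∀ a → toℕ (w ⊞ a) ≈ toℕ a + (toℕ w + 0)
    toℕ-w⊞ a = trans (toℕ-⊞ w a) (≡⇒≈ (regroup (toℕ w) (toℕ a)))
      where
      regroup : ∀ w a → w + a ≡ a + (w + 0)
      regroup = solve-∀
  □◇^-sat V (suc n) w = mk⇔ necessary sufficient
    where
    necessary : Sat F₂ V w (□◇^ (suc n) (□ p)) → ∀ x → x ∈A+ toℕ w + suc n * k → V x ≡ true
    necessary sat x (b , b∈A , x≈) with sat (w ⊞ b) (b , b∈A , refl)
    ... | v′ , (a , a∈A , refl) , sat′ =
      to (□◇^-sat V n v′) sat′ x ([ k ] ⊟ a , k-symmetric a a∈A , (begin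
        toℕ x                                ≈⟨ x≈ ⟩
        toℕ b + (toℕ w + (k + n * k))        ≡⟨ regroup (toℕ b) (toℕ w) (k + n * k) ⟩
        toℕ w + toℕ b + (k + n * k)          ≈⟨ +-cong (toℕ-⊞ w b) refl ⟨
        toℕ (w ⊞ b) + (k + n * k)            ≈⟨ ⊞-⊟-cancel (w ⊞ b) a (n * k) ⟨
        toℕ ([ k ] ⊟ a) + (toℕ v′ + n * k)   ∎))
      where
      open ≈-Reasoning
      regroup : ∀ b w m → b + (w + m) ≡ w + b + m
      regroup = solve-∀
    sufficient : (∀ x → x ∈A+ toℕ w + suc n * k → V x ≡ true) → Sat F₂ V w (□◇^ (suc n) (□ p))
    sufficient h _ (b , b∈A , refl) =
      v′ , ([ k ] ⊟ b , k-symmetric b b∈A , refl) , from (□◇^-sat V n v′) λ x (a , a∈A , x≈) →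
        h x (a , a∈A , trans x≈ (+-cong {toℕ a} refl v′-shift))
      where
      v′ = w ⊞ b ⊞ ([ k ] ⊟ b)
      v′-shift : toℕ v′ + n * k ≈ toℕ w + (k + n * k)
      v′-shift = trans (+-cong (⊟-⊞-cancel w b) refl) (≡⇒≈ (+-assoc (toℕ w) k (n * k)))

  frame₂-sat : ∀ V n → Sat F₂ V [ 0 ] (□◇^ n (□ p)) ⇔ (∀ x → Translate n x → V x ≡ true)
  frame₂-sat V n = mk⇔
    (λ sat x x∈ → to (□◇^-sat V n w₀) sat x (∈A+-resp (sym w₀-shift) x∈))
    (λ h → from (□◇^-sat V n w₀) λ x x∈ → h x (∈A+-resp w₀-shift x∈))
    where
    w₀ = [ 0 ]
    w₀-shift : toℕ w₀ + n * k ≈ n * k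
    w₀-shift = +-cong (toℕ-mod 0) refl

  Γ₂-negFree : ∀ φ → Γ₂ φ → NegFree φ → ∃ λ n → φ ≡ □◇^ n (□ p)
  Γ₂-negFree φ (j , inj₁ refl) _ = j , refl
  Γ₂-negFree φ (j , inj₂ refl) ()

  frame₂-model : PointModel F₂ [ 0 ] Γ₂ Translate
  frame₂-model = record
    { fm              = λ n → □◇^ n (□ p)
    ; fm-injective    = □◇^-injective
    ; fm-negFree      = λ n → □◇^-negFree n tt
    ; fm∈Γ            = λ n → n , inj₁ refl
    ; ¬fm∈Γ           = λ n → n , inj₂ refl
    ; Γ-negFree       = Γ₂-negFree
    ; restrict        = λ V → V
    ; extend          = λ U → U
    ; restrict-extend = λ _ _ → refl
    ; sat⇔            = frame₂-sat
    }

theorem3 : (r k : ℕ) .{{_ : NonZero r}} → Coprime r k → 1 ≤ k → 3 * k < r →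
    (A : Subset r) → ⟦_⟧ r 0 ∈ A → ⟦_⟧ r k ∈ A →
    (∀ a → a ∈ A → Interval r 0 k a) →
    ImpossibilityFrame (Frame₁ r k A) (inj₁ tt) Γ₁ ×
    (KSymmetric r k A → ImpossibilityFrame (Frame₂ r A) (⟦_⟧ r 0) Γ₂)
theorem3 r k r⊥k 1≤k 3k<r A 0∈A k∈A A⊆[0,k] =
  Impossibility.impossibilityFrame Translate? (Frame₁Semantics.frame₁-model r k A) forward backward ,
  λ k-symmetric →
    Impossibility.impossibilityFrame Translate? (Frame₂Semantics.frame₂-model r k A k-symmetric) forward backward
  where
  open Translates r k A using (Translate?)
  open Steps r k r⊥k 1≤k 3k<r A 0∈A k∈A A⊆[0,k] using (forward; backward)
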